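{- Let $n,D\in\mathbb{N}$, let $r$ be a positive integer and $\varepsilon>0$, and suppose that $0<1/n\ll\rho\ll\nu\ll\tau\ll1/r<1$ and $\rho^{1/3}\le\varepsilon/2$. Let $G$ be a $D$-regular graph on $n$ vertices with $D\ge(1/r+\varepsilon)n$ and let $\mathcal V$ be a robust partition of $G$ with parameters $\rho,\nu,\tau,k,\ell$. Then $k+2\ell\le r-1$, and so $\ell\le\lfloor(r-1)/2\rfloor$ and $k\le r-1-2\ell$. In particular: (i) if $r=4$ then $(k,\ell)\in\mathcal S:=\{(1,0),(2,0),(3,0),(0,1),(1,1)\}$; (ii) if $r=5$ then $(k,\ell)\in\mathcal S\cup\{(4,0),(2,1),(0,2)\}$.
   Context: Hierarchy convention: a hypothesis $0<1/n\ll a\ll b\ll c\le 1$ means there is a non-decreasing function $f:(0,1]\to(0,1]$ such that the statement holds for all $a,b,c\in(0,1]$ and $n$ with $b\le f(c)$, $a\le f(b)$, $1/n\le f(a)$ (analogously for more constants). All graphs are finite and simple. For $X\subseteq V(G)$, $\overline{X}=V(G)\setminus X$ and $d_X(x)$ is the number of neighbours of $x$ in $X$; $e(A,B)$ is the number of edges with one endpoint in $A$ and the other in $B$; $G[A,B]$ is the bipartite subgraph of edges between disjoint $A$ and $B$. For a graph $H$ on $N$ vertices, $RN_{\nu,H}(S)$ is the set of vertices with at least $\nu N$ neighbours in $S$; $H$ is a robust $(\nu,\tau)$-expander if $|RN_{\nu,H}(S)|\ge|S|+\nu N$ whenever $\tau N\le|S|\le(1-\tau)N$; for a partition $A,B$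 of $V(H)$, $H$ is a bipartite robust $(\nu,\tau)$-expander with bipartition $A,B$ if every $S\subseteq A$ with $\tau|A|\le|S|\le(1-\tau)|A|$ satisfies $|RN_{\nu,H}(S)\cap B|\ge|S|+\nu N$. In a graph $G$ on $n$ vertices, $U$ is a $\rho$-component if $|U|\ge\sqrt\rho n$ and $e(U,\overline U)\le\rho n^2$; $G[U]$ is $\rho$-close to bipartite with bipartition $U_1,U_2$ if $U=U_1\sqcup U_2$, $|U_1|,|U_2|\ge\sqrt\rho n$, $||U_1|-|U_2||\le\rho n$ and $e(U_1,\overline{U_2})+e(U_2,\overline{U_1})\le\rho n^2$; a $(\rho,\nu,\tau)$-robust expander component is a $\rho$-component $U$ with $G[U]$ a robust $(\nu,\tau)$-expander; a bipartite $(\rho,\nu,\tau)$-robust expander component with bipartition $A,B$ is $G[U]$ that is $\rho$-close to bipartite with bipartition $A,B$ and a bipartite robust $(\nu,\tau)$-expander with bipartition $A,B$. A robust partition of a $D$-regular graph $G$ on $n$ vertices with parameters $\rho,\nu,\tau,k,\ell$ ($k,\ell$ non-negative integers, $0<\rho\le\nu\le\tau<1$) is a partition $\{V_1,\dots,V_k,W_1,\dots,W_\ell\}$ of $V(G)$ such that: each $G[V_i]$ is a $(\rho,\nu,\tau)$-robust expander component; each $W_j$ has a partition $A_j,B_j$ with $G[W_j]$ a bipartite $(\rho,\nu,\tau)$-robust expander component with bipartition $A_j,B_j$; for all parts $X,X'$ and $x\in X$, $d_X(x)\ge d_{X'}(x)$ (so $d_X(x)\ge D/(k+\ell)$); $d_{B_j}(u)\ge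 d_{A_j}(u)$ for $u\in A_j$ and $d_{A_j}(v)\ge d_{B_j}(v)$ for $v\in B_j$ (so $\delta(G[A_j,B_j])\ge D/2(k+\ell)$); $k+2\ell\le\lfloor(1+\rho^{1/3})n/D\rfloor$; and in every part $X$ all but at most $\rho n$ vertices $x$ satisfy $d_X(x)\ge D-\rho n$.
   Formalization: The constants $\varepsilon$, $\rho$, $\nu$, $\tau$ range over the rationals, and the hierarchy function $f$ is taken as a map from rationals to rationals. -}

module Defs where

open import Data.Nat as ℕ using (ℕ; zero; suc)
open import Data.Integer as ℤ using (+_)
open import Data.Bool using (Bool; true; false; _∧_; _∨_; not)
open import Data.Fin using (Fin; toℕ)
open import Data.Fin.Subset using (Subset; _∈_; _⊆_; _∩_; _∪_; ∁; ∣_∣; ⊥)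
open import Data.Vec as Vec using (tabulate; lookup)
open import Data.Rational as ℚ using (ℚ; 0ℚ; 1ℚ)
open import Data.Rational.Properties as ℚP using ()
open import Data.Product using (Σ; ∃-syntax; _×_; _,_)
open import Data.Sum using (_⊎_; inj₁; inj₂)
open import Relation.Binary.PropositionalEquality using (_≡_)
open import Relation.Nullary using (does)

-- Rationals stand in for the real parameters.

ℕ→ℚ : ℕ → ℚ
ℕ→ℚ m = (+ m) ℚ./ 1

-- 1/r (with the dummy value 0 for r = 0, never used since r ≥ 2)
inv : ℕ → ℚ
inv zero = 0ℚ
inv (suc m) = (+ 1) ℚ./ suc m

absDiffℚ : ℚ → ℚ → ℚ
absDiffℚ p q = ℚ.∣ p ℚ.- q ∣

-- "x ≤ c^{1/3} · y" for c ≥ 0, y ≥ 0 (real cube root), stated without roots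
LeCbrtTimes : ℚ → ℚ → ℚ → Set
LeCbrtTimes x c y = (x ℚ.≤ 0ℚ) ⊎ (x ℚ.* x ℚ.* x ℚ.≤ c ℚ.* (y ℚ.* y ℚ.* y))

-- "√c · y ≤ m" for c ≥ 0, y ≥ 0, m ≥ 0, stated without roots
SqrtTimesLe : ℚ → ℚ → ℚ → Set
SqrtTimesLe c y m = c ℚ.* (y ℚ.* y) ℚ.≤ m ℚ.* m

record Graph (n : ℕ) : Set where
  field
    adj        : Fin n → Fin n → Bool
    adj-sym    : ∀ x y → adj x y ≡ adj y x
    adj-irrefl : ∀ x → adj x x ≡ false

𝟙 : Bool → ℕ
𝟙 true = 1
𝟙 false = 0

Σfin : (n : ℕ) → (Fin n → ℕ) → ℕ
Σfin n f = Vec.sum (tabulate f)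

module _ {n : ℕ} (G : Graph n) where
  open Graph G

  nbhd : Fin n → Subset n
  nbhd x = tabulate (adj x)

  deg-in : Subset n → Fin n → ℕ
  deg-in X x = ∣ X ∩ nbhd x ∣

  IsRegular : ℕ → Set
  IsRegular D = ∀ x → ∣ nbhd x ∣ ≡ D

  eCount : Subset n → Subset n → ℕ
  eCount A B = Σfin n λ x → Σfin n λ y →
    𝟙 ((toℕ x ℕ.<ᵇ toℕ y) ∧ adj x y ∧
       ((lookup A x ∧ lookup B y) ∨ (lookup B x ∧ lookup A y)))

  -- RN_{ν,H}(S) for H = G[U] with N = |U|: vertices of U with ≥ νN neighbours in S
  RN : ℚ → Subset n → Subset n → Subset n
  RN ν U S = tabulate λ v →
    lookup U v ∧ does ((ν ℚ.* ℕ→ℚ ∣ U ∣) ℚP.≤? ℕ→ℚ (deg-in S v))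

  IsRobustExpander : ℚ → ℚ → Subset n → Set
  IsRobustExpander ν τ U = ∀ (S : Subset n) → S ⊆ U →
    τ ℚ.* ℕ→ℚ ∣ U ∣ ℚ.≤ ℕ→ℚ ∣ S ∣ →
    ℕ→ℚ ∣ S ∣ ℚ.≤ (1ℚ ℚ.- τ) ℚ.* ℕ→ℚ ∣ U ∣ →
    ℕ→ℚ ∣ S ∣ ℚ.+ ν ℚ.* ℕ→ℚ ∣ U ∣ ℚ.≤ ℕ→ℚ ∣ RN ν U S ∣

  IsBipartiteRobustExpander : ℚ → ℚ → Subset n → Subset n → Set
  IsBipartiteRobustExpander ν τ A B = ∀ (S : Subset n) → S ⊆ A →
    τ ℚ.* ℕ→ℚ ∣ A ∣ ℚ.≤ ℕ→ℚ ∣ S ∣ →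
    ℕ→ℚ ∣ S ∣ ℚ.≤ (1ℚ ℚ.- τ) ℚ.* ℕ→ℚ ∣ A ∣ →
    ℕ→ℚ ∣ S ∣ ℚ.+ ν ℚ.* ℕ→ℚ ∣ A ∪ B ∣ ℚ.≤ ℕ→ℚ ∣ RN ν (A ∪ B) S ∩ B ∣

  IsComponent : ℚ → Subset n → Set
  IsComponent ρ U =
    SqrtTimesLe ρ (ℕ→ℚ n) (ℕ→ℚ ∣ U ∣) ×
    ℕ→ℚ (eCount U (∁ U)) ℚ.≤ ρ ℚ.* (ℕ→ℚ n ℚ.* ℕ→ℚ n)

  IsCloseToBipartite : ℚ → Subset n → Subset n → Subset n → Set
  IsCloseToBipartite ρ U U₁ U₂ =
    (U₁ ∩ U₂ ≡ ⊥) × (U₁ ∪ U₂ ≡ U) ×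
    SqrtTimesLe ρ (ℕ→ℚ n) (ℕ→ℚ ∣ U₁ ∣) ×
    SqrtTimesLe ρ (ℕ→ℚ n) (ℕ→ℚ ∣ U₂ ∣) ×
    absDiffℚ (ℕ→ℚ ∣ U₁ ∣) (ℕ→ℚ ∣ U₂ ∣) ℚ.≤ ρ ℚ.* ℕ→ℚ n ×
    ℕ→ℚ (eCount U₁ (∁ U₂) ℕ.+ eCount U₂ (∁ U₁)) ℚ.≤ ρ ℚ.* (ℕ→ℚ n ℚ.* ℕ→ℚ n)

  IsRobustExpanderComponent : ℚ → ℚ → ℚ → Subset n → Set
  IsRobustExpanderComponent ρ ν τ U = IsComponent ρ U × IsRobustExpander ν τ U

  IsBipartiteRobustExpanderComponent : ℚ → ℚ → ℚ → Subset n → Subset n → Set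
  IsBipartiteRobustExpanderComponent ρ ν τ A B =
    IsCloseToBipartite ρ (A ∪ B) A B × IsBipartiteRobustExpander ν τ A B

  parts : {k ℓ : ℕ} → (Fin k → Subset n) → (Fin ℓ → Subset n) → (Fin ℓ → Subset n) →
          Fin k ⊎ Fin ℓ → Subset n
  parts V A B (inj₁ i) = V i
  parts V A B (inj₂ j) = A j ∪ B j

  lowDeg : ℕ → ℚ → Subset n → Subset n
  lowDeg D ρ X = tabulate λ x →
    lookup X x ∧ does (ℕ→ℚ (deg-in X x) ℚP.<? ℕ→ℚ D ℚ.- ρ ℚ.* ℕ→ℚ n)

  IsRobustPartition : (D : ℕ) (ρ ν τ : ℚ) (k ℓ : ℕ)
      (V : Fin k → Subset n) (A B : Fin ℓ → Subset n) → Set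
  IsRobustPartition D ρ ν τ k ℓ V A B =
      ((0ℚ ℚ.< ρ) × (ρ ℚ.≤ ν) × (ν ℚ.≤ τ) × (τ ℚ.< 1ℚ)) ×
      (∀ (x : Fin n) → Σ (Fin k ⊎ Fin ℓ) λ p → (x ∈ parts V A B p) ×
                   (∀ (q : Fin k ⊎ Fin ℓ) → x ∈ parts V A B q → q ≡ p)) ×
      (∀ (i : Fin k) → IsRobustExpanderComponent ρ ν τ (V i)) ×
      (∀ (j : Fin ℓ) → A j ∩ B j ≡ ⊥) ×
      (∀ (j : Fin ℓ) → IsBipartiteRobustExpanderComponent ρ ν τ (A j) (B j)) ×
      (∀ (p q : Fin k ⊎ Fin ℓ) (x : Fin n) → x ∈ parts V A B p →
                   deg-in (parts V A B q) x ℕ.≤ deg-in (parts V A B p) x) ×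
      (∀ (j : Fin ℓ) (u : Fin n) → u ∈ A j → deg-in (A j) u ℕ.≤ deg-in (B j) u) ×
      (∀ (j : Fin ℓ) (v : Fin n) → v ∈ B j → deg-in (B j) v ℕ.≤ deg-in (A j) v) ×
      -- k + 2ℓ ≤ ⌊(1 + ρ^{1/3}) n / D⌋, i.e. (k+2ℓ)·D - n ≤ ρ^{1/3}·n (for D > 0)
      LeCbrtTimes (ℕ→ℚ ((k ℕ.+ 2 ℕ.* ℓ) ℕ.* D) ℚ.- ℕ→ℚ n) ρ (ℕ→ℚ n) ×
      (∀ (p : Fin k ⊎ Fin ℓ) → ℕ→ℚ ∣ lowDeg D ρ (parts V A B p) ∣ ℚ.≤ ρ ℚ.* ℕ→ℚ n)

IsHierarchyFn : (ℚ → ℚ) → Set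
IsHierarchyFn f =
  (∀ x → 0ℚ ℚ.< x → x ℚ.≤ 1ℚ → (0ℚ ℚ.< f x) × (f x ℚ.≤ 1ℚ)) ×
  (∀ x y → 0ℚ ℚ.< x → x ℚ.≤ y → y ℚ.≤ 1ℚ → f x ℚ.≤ f y)

InS : ℕ → ℕ → Set
InS k ℓ = ((k ≡ 1) × (ℓ ≡ 0)) ⊎ ((k ≡ 2) × (ℓ ≡ 0)) ⊎ ((k ≡ 3) × (ℓ ≡ 0)) ⊎
          ((k ≡ 0) × (ℓ ≡ 1)) ⊎ ((k ≡ 1) × (ℓ ≡ 1))

InS5 : ℕ → ℕ → Set
InS5 k ℓ = InS k ℓ ⊎ ((k ≡ 4) × (ℓ ≡ 0)) ⊎ ((k ≡ 2) × (ℓ ≡ 1)) ⊎ ((k ≡ 0) × (ℓ ≡ 2))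

-- A robust partition satisfies k + 2ℓ ≤ (1 + ρ^{1/3})·n/D, i.e. its excess (k + 2ℓ)·D − n is at
-- most ρ^{1/3}·n ≤ (ε/2)·n. If k + 2ℓ ≥ r, the degree bound gives (k + 2ℓ)·D ≥ r·(1/r + ε)·n ≥ n + εn,
-- so the excess would be at least εn. Hence k + 2ℓ ≤ r − 1, and for r = 4, 5 the listed pairs are
-- those with k + 2ℓ ≤ r − 1 other than (0,0), which is excluded because a partition of n ≥ 1
-- vertices has a part.
module Submission where

open import Defs
open import Data.Nat as ℕ using (ℕ; zero; suc; _≤_; _∸_; _/_; _*_; _+_; z≤n; s≤s)
import Data.Nat.Properties as ℕP
open import Data.Nat.DivMod using (/-monoˡ-≤; m*n/n≡m)
open import Data.Nat.Coprimality as Coprimality using (1-coprimeTo)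
open import Data.Integer as ℤ using (+_)
import Data.Integer.Properties as ℤP
open import Data.Fin using (Fin; fromℕ<)
open import Data.Fin.Subset using (Subset)
open import Data.Rational as ℚ using (ℚ; 0ℚ; 1ℚ; positive; nonNegative)
open import Data.Rational.Properties
open import Data.Rational.Solver using (module +-*-Solver)
import Data.Rational.Unnormalised as ℚᵘ
import Data.Rational.Unnormalised.Properties as ℚᵘP
open import Data.Product using (∃-syntax; _×_; _,_; proj₁)
open import Data.Sum using (_⊎_; inj₁; inj₂)
open import Relation.Nullary using (yes; no; contradiction)
open import Relation.Binary.PropositionalEquality

open +-*-Solver

toℚᵘ-ℕ→ℚ : ∀ m → ℚ.toℚᵘ (ℕ→ℚ m) ≡ ℚᵘ.mkℚᵘ (+ m) 0
toℚᵘ-ℕ→ℚ m rewrite normalize-coprime (Coprimality.sym (1-coprimeTo m)) = refl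

toℚᵘ-inv : ∀ m → ℚ.toℚᵘ (inv (suc m)) ≡ ℚᵘ.mkℚᵘ (+ 1) m
toℚᵘ-inv m rewrite normalize-coprime (1-coprimeTo (suc m)) = refl

ℕ→ℚ-mono-≤ : ∀ {a b} → a ≤ b → ℕ→ℚ a ℚ.≤ ℕ→ℚ b
ℕ→ℚ-mono-≤ {a} {b} a≤b = toℚᵘ-cancel-≤
  (subst₂ ℚᵘ._≤_ (sym (toℚᵘ-ℕ→ℚ a)) (sym (toℚᵘ-ℕ→ℚ b))
    (ℚᵘ.*≤* (ℤP.*-monoʳ-≤-nonNeg (+ 1) (ℤ.+≤+ a≤b))))

ℕ→ℚ-nonNeg : ∀ m → 0ℚ ℚ.≤ ℕ→ℚ m
ℕ→ℚ-nonNeg m = ℕ→ℚ-mono-≤ {0} {m} z≤n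

ℕ→ℚ-homo-* : ∀ a b → ℕ→ℚ (a * b) ≡ ℕ→ℚ a ℚ.* ℕ→ℚ b
ℕ→ℚ-homo-* a b = toℚᵘ-injective (begin
  ℚ.toℚᵘ (ℕ→ℚ (a * b))                    ≡⟨ toℚᵘ-ℕ→ℚ (a * b) ⟩
  ℚᵘ.mkℚᵘ (+ (a * b)) 0                   ≈⟨ ℚᵘ.*≡* (cong (ℤ._* + 1) (ℤP.pos-* a b)) ⟩
  ℚᵘ.mkℚᵘ (+ a) 0 ℚᵘ.* ℚᵘ.mkℚᵘ (+ b) 0    ≡⟨ cong₂ ℚᵘ._*_ (toℚᵘ-ℕ→ℚ a) (toℚᵘ-ℕ→ℚ b) ⟨
  ℚ.toℚᵘ (ℕ→ℚ a) ℚᵘ.* ℚ.toℚᵘ (ℕ→ℚ b)     ≈⟨ toℚᵘ-homo-* (ℕ→ℚ a) (ℕ→ℚ b) ⟨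
  ℚ.toℚᵘ (ℕ→ℚ a ℚ.* ℕ→ℚ b)               ∎)
  where open ℚᵘP.≃-Reasoning

ℕ→ℚ*inv≡1 : ∀ m → ℕ→ℚ (suc m) ℚ.* inv (suc m) ≡ 1ℚ
ℕ→ℚ*inv≡1 m = toℚᵘ-injective (begin
  ℚ.toℚᵘ (ℕ→ℚ (suc m) ℚ.* inv (suc m))            ≈⟨ toℚᵘ-homo-* (ℕ→ℚ (suc m)) (inv (suc m)) ⟩
  ℚ.toℚᵘ (ℕ→ℚ (suc m)) ℚᵘ.* ℚ.toℚᵘ (inv (suc m))  ≡⟨ cong₂ ℚᵘ._*_ (toℚᵘ-ℕ→ℚ (suc m)) (toℚᵘ-inv m) ⟩
  ℚᵘ.mkℚᵘ (+ suc m) 0 ℚᵘ.* ℚᵘ.mkℚᵘ (+ 1) m        ≈⟨ ℚᵘ.*≡* (trans (ℤP.*-identityʳ _) (trans (ℤP.*-identityʳ _)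
                                                      (sym (trans (ℤP.*-identityˡ _) (cong (λ j → + suc j) (ℕP.+-identityʳ m)))))) ⟩
  ℚᵘ.1ℚᵘ                                         ∎)
  where open ℚᵘP.≃-Reasoning

cube-mono-≤ : ∀ {a b} → 0ℚ ℚ.≤ a → a ℚ.≤ b → a ℚ.* a ℚ.* a ℚ.≤ b ℚ.* b ℚ.* b
cube-mono-≤ {a} {b} 0≤a a≤b = begin
  a ℚ.* a ℚ.* a ≤⟨ *-monoʳ-≤-nonNeg a (*-monoˡ-≤-nonNeg a a≤b) ⟩
  a ℚ.* b ℚ.* a ≤⟨ *-monoʳ-≤-nonNeg a (*-monoʳ-≤-nonNeg b a≤b) ⟩
  b ℚ.* b ℚ.* a ≤⟨ *-monoˡ-≤-nonNeg (b ℚ.* b) {{nonNeg*nonNeg⇒nonNeg b b}} a≤b ⟩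
  b ℚ.* b ℚ.* b ∎
  where
  open ≤-Reasoning
  instance
    a-nonNeg : ℚ.NonNegative a
    a-nonNeg = nonNegative 0≤a
    b-nonNeg : ℚ.NonNegative b
    b-nonNeg = nonNegative (≤-trans 0≤a a≤b)

⅛ : ℚ
⅛ = + 1 ℚ./ 8

-- x ≤ c^{1/3}·y ≤ (ε/2)·y < ε·y, argued with cubes.
LeCbrtTimes⇒< : ∀ {x c y ε} → 0ℚ ℚ.< ε → 0ℚ ℚ.< y → c ℚ.≤ ε ℚ.* ε ℚ.* ε ℚ.* ⅛ →
                LeCbrtTimes x c y → x ℚ.< ε ℚ.* y
LeCbrtTimes⇒< {x} {c} {y} {ε} 0<ε 0<y c≤ε³/8 (inj₁ x≤0) =
  ≤-<-trans x≤0 (positive⁻¹ (ε ℚ.* y) {{pos*pos⇒pos ε {{positive 0<ε}} y {{positive 0<y}}}})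
LeCbrtTimes⇒< {x} {c} {y} {ε} 0<ε 0<y c≤ε³/8 (inj₂ x³≤cy³) with x ℚ.<? ε ℚ.* y
... | yes x<εy = x<εy
... | no x≮εy = contradiction x³<x³ (<-irrefl refl)
  where
  open ≤-Reasoning
  instance
    ε-pos : ℚ.Positive ε
    ε-pos = positive 0<ε
    y-pos : ℚ.Positive y
    y-pos = positive 0<y
  y³ εy³ : ℚ
  y³ = y ℚ.* y ℚ.* y
  εy³ = (ε ℚ.* y) ℚ.* (ε ℚ.* y) ℚ.* (ε ℚ.* y)
  0<εy : 0ℚ ℚ.< ε ℚ.* y
  0<εy = positive⁻¹ (ε ℚ.* y) {{pos*pos⇒pos ε y}}
  instance
    y³-nonNeg : ℚ.NonNegative y³
    y³-nonNeg = pos⇒nonNeg y³ {{pos*pos⇒pos (y ℚ.* y) {{pos*pos⇒pos y y}} y}}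
    εy-pos : ℚ.Positive (ε ℚ.* y)
    εy-pos = positive 0<εy
    εy³-pos : ℚ.Positive εy³
    εy³-pos = pos*pos⇒pos (ε ℚ.* y ℚ.* (ε ℚ.* y)) {{pos*pos⇒pos (ε ℚ.* y) (ε ℚ.* y)}} (ε ℚ.* y)
  ⅛<1 : ⅛ ℚ.< 1ℚ
  ⅛<1 = ℚ.*<* (ℤ.+<+ (s≤s (s≤s z≤n)))
  x³<x³ : x ℚ.* x ℚ.* x ℚ.< x ℚ.* x ℚ.* x
  x³<x³ = begin-strict
    x ℚ.* x ℚ.* x              ≤⟨ x³≤cy³ ⟩
    c ℚ.* y³                   ≤⟨ *-monoʳ-≤-nonNeg y³ c≤ε³/8 ⟩
    ε ℚ.* ε ℚ.* ε ℚ.* ⅛ ℚ.* y³  ≡⟨ solve 3 (λ ε y e → ε :* ε :* ε :* e :* (y :* y :* y) := (ε :* y) :* (ε :* y) :* (ε :* y) :* e) refl ε y ⅛ ⟩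
    εy³ ℚ.* ⅛                  <⟨ *-monoʳ-<-pos εy³ ⅛<1 ⟩
    εy³ ℚ.* 1ℚ                 ≡⟨ *-identityʳ εy³ ⟩
    εy³                        ≤⟨ cube-mono-≤ (<⇒≤ 0<εy) (≮⇒≥ x≮εy) ⟩
    x ℚ.* x ℚ.* x              ∎

degree-excess : ∀ {m K D n ε} → 0ℚ ℚ.≤ ε → (inv (suc m) ℚ.+ ε) ℚ.* ℕ→ℚ n ℚ.≤ ℕ→ℚ D → suc m ≤ K →
                ε ℚ.* ℕ→ℚ n ℚ.≤ ℕ→ℚ (K * D) ℚ.- ℕ→ℚ n
degree-excess {m} {K} {D} {n} {ε} 0≤ε D-large r≤K = begin
  ε ℚ.* N                               ≡⟨ *-identityˡ (ε ℚ.* N) ⟨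
  1ℚ ℚ.* (ε ℚ.* N)                      ≤⟨ *-monoʳ-≤-nonNeg (ε ℚ.* N) (ℕ→ℚ-mono-≤ {1} {suc m} (s≤s z≤n)) ⟩
  R ℚ.* (ε ℚ.* N)                       ≡⟨ cancel ⟨
  R ℚ.* ((I ℚ.+ ε) ℚ.* N) ℚ.- N         ≤⟨ +-monoˡ-≤ (ℚ.- N) (*-monoˡ-≤-nonNeg R D-large) ⟩
  R ℚ.* ℕ→ℚ D ℚ.- N                     ≡⟨ cong (ℚ._- N) (ℕ→ℚ-homo-* (suc m) D) ⟨
  ℕ→ℚ (suc m * D) ℚ.- N                 ≤⟨ +-monoˡ-≤ (ℚ.- N) (ℕ→ℚ-mono-≤ (ℕP.*-monoˡ-≤ D r≤K)) ⟩
  ℕ→ℚ (K * D) ℚ.- N                     ∎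
  where
  open ≤-Reasoning
  N R I : ℚ
  N = ℕ→ℚ n
  R = ℕ→ℚ (suc m)
  I = inv (suc m)
  instance
    N-nonNeg : ℚ.NonNegative N
    N-nonNeg = nonNegative (ℕ→ℚ-nonNeg n)
    R-nonNeg : ℚ.NonNegative R
    R-nonNeg = nonNegative (ℕ→ℚ-nonNeg (suc m))
    εN-nonNeg : ℚ.NonNegative (ε ℚ.* N)
    εN-nonNeg = nonNeg*nonNeg⇒nonNeg ε {{nonNegative 0≤ε}} N
  cancel : R ℚ.* ((I ℚ.+ ε) ℚ.* N) ℚ.- N ≡ R ℚ.* (ε ℚ.* N)
  cancel = begin-equality
    R ℚ.* ((I ℚ.+ ε) ℚ.* N) ℚ.- N               ≡⟨ solve 4 (λ R I ε N → R :* ((I :+ ε) :* N) :- N := R :* I :* N :+ R :* (ε :* N) :- N) refl R I ε N ⟩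
    R ℚ.* I ℚ.* N ℚ.+ R ℚ.* (ε ℚ.* N) ℚ.- N     ≡⟨ cong (λ t → t ℚ.* N ℚ.+ R ℚ.* (ε ℚ.* N) ℚ.- N) (ℕ→ℚ*inv≡1 m) ⟩
    1ℚ ℚ.* N ℚ.+ R ℚ.* (ε ℚ.* N) ℚ.- N          ≡⟨ solve 3 (λ R ε N → con 1ℚ :* N :+ R :* (ε :* N) :- N := R :* (ε :* N)) refl R ε N ⟩
    R ℚ.* (ε ℚ.* N)                             ∎

bounded-excess⇒<r : ∀ {n D m K ε ρ} → 1 ≤ n → 0ℚ ℚ.< ε → ρ ℚ.≤ ε ℚ.* ε ℚ.* ε ℚ.* ⅛ →
           (inv (suc m) ℚ.+ ε) ℚ.* ℕ→ℚ n ℚ.≤ ℕ→ℚ D →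
           LeCbrtTimes (ℕ→ℚ (K * D) ℚ.- ℕ→ℚ n) ρ (ℕ→ℚ n) → K ≤ m
bounded-excess⇒<r {n} {D} {m} {K} {ε} 1≤n 0<ε ρ≤ε³/8 D-large excess with K ℕ.≤? m
... | yes K≤m = K≤m
... | no K≰m = contradiction (<-≤-trans excess<εn εn≤excess) (<-irrefl refl)
  where
  0<n : 0ℚ ℚ.< ℕ→ℚ n
  0<n = <-≤-trans (positive⁻¹ 1ℚ) (ℕ→ℚ-mono-≤ {1} {n} 1≤n)
  excess<εn : ℕ→ℚ (K * D) ℚ.- ℕ→ℚ n ℚ.< ε ℚ.* ℕ→ℚ n
  excess<εn = LeCbrtTimes⇒< 0<ε 0<n ρ≤ε³/8 excess
  εn≤excess : ε ℚ.* ℕ→ℚ n ℚ.≤ ℕ→ℚ (K * D) ℚ.- ℕ→ℚ n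
  εn≤excess = degree-excess {m} {K} {D} {n} (<⇒≤ 0<ε) D-large (ℕP.≰⇒> K≰m)

halve : ∀ {ℓ m} → 2 * ℓ ≤ m → ℓ ≤ m / 2
halve {ℓ} {m} 2ℓ≤m = begin
  ℓ          ≡⟨ m*n/n≡m ℓ 2 ⟨
  ℓ * 2 / 2  ≡⟨ cong (_/ 2) (ℕP.*-comm ℓ 2) ⟩
  2 * ℓ / 2  ≤⟨ /-monoˡ-≤ 2 2ℓ≤m ⟩
  m / 2      ∎
  where open ℕP.≤-Reasoning

InS-complete : ∀ {k ℓ} → ℓ ≤ 1 → k ≤ 3 ∸ 2 * ℓ → Fin k ⊎ Fin ℓ → InS k ℓ
InS-complete z≤n       z≤n                   (inj₁ ())
InS-complete z≤n       z≤n                   (inj₂ ())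
InS-complete z≤n       (s≤s z≤n)             _ = inj₁ (refl , refl)
InS-complete z≤n       (s≤s (s≤s z≤n))       _ = inj₂ (inj₁ (refl , refl))
InS-complete z≤n       (s≤s (s≤s (s≤s z≤n))) _ = inj₂ (inj₂ (inj₁ (refl , refl)))
InS-complete (s≤s z≤n) z≤n                   _ = inj₂ (inj₂ (inj₂ (inj₁ (refl , refl))))
InS-complete (s≤s z≤n) (s≤s z≤n)             _ = inj₂ (inj₂ (inj₂ (inj₂ (refl , refl))))

InS5-complete : ∀ {k ℓ} → ℓ ≤ 2 → k ≤ 4 ∸ 2 * ℓ → Fin k ⊎ Fin ℓ → InS5 k ℓ
InS5-complete z≤n             (s≤s (s≤s (s≤s (s≤s z≤n)))) _ = inj₂ (inj₁ (refl , refl))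
InS5-complete (s≤s z≤n)       (s≤s (s≤s z≤n))             _ = inj₂ (inj₂ (inj₁ (refl , refl)))
InS5-complete (s≤s (s≤s z≤n)) z≤n                         _ = inj₂ (inj₂ (inj₂ (refl , refl)))
InS5-complete z≤n             z≤n                         p = inj₁ (InS-complete z≤n z≤n p)
InS5-complete z≤n             (s≤s z≤n)                   p = inj₁ (InS-complete z≤n (s≤s z≤n) p)
InS5-complete z≤n             (s≤s (s≤s z≤n))             p = inj₁ (InS-complete z≤n (s≤s (s≤s z≤n)) p)
InS5-complete z≤n             (s≤s (s≤s (s≤s z≤n)))       p = inj₁ (InS-complete z≤n (s≤s (s≤s (s≤s z≤n))) p)
InS5-complete (s≤s z≤n)       z≤n                         p = inj₁ (InS-complete (s≤s z≤n) z≤n p)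
InS5-complete (s≤s z≤n)       (s≤s z≤n)                   p = inj₁ (InS-complete (s≤s z≤n) (s≤s z≤n) p)

robustPartition-bounds :
  ∀ {n D m k ℓ ε ρ ν τ} {G : Graph n} {V : Fin k → Subset n} {A B : Fin ℓ → Subset n} →
  1 ≤ n → 0ℚ ℚ.< ε → ρ ℚ.≤ ε ℚ.* ε ℚ.* ε ℚ.* ⅛ →
  (inv (suc m) ℚ.+ ε) ℚ.* ℕ→ℚ n ℚ.≤ ℕ→ℚ D →
  IsRobustPartition G D ρ ν τ k ℓ V A B →
  (k + 2 * ℓ ≤ m) × (ℓ ≤ m / 2) × (k ≤ m ∸ 2 * ℓ) ×
  (suc m ≡ 4 → InS k ℓ) × (suc m ≡ 5 → InS5 k ℓ)
robustPartition-bounds {n} {D} {m} {k} {ℓ} 1≤n 0<ε ρ≤ε³/8 D-large (_ , cover , _ , _ , _ , _ , _ , _ , excess , _) =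
  k+2ℓ≤m , ℓ≤m/2 , k≤m∸2ℓ ,
  (λ { refl → InS-complete ℓ≤m/2 k≤m∸2ℓ somePart }) ,
  (λ { refl → InS5-complete ℓ≤m/2 k≤m∸2ℓ somePart })
  where
  k+2ℓ≤m : k + 2 * ℓ ≤ m
  k+2ℓ≤m = bounded-excess⇒<r {n} {D} {m} {k + 2 * ℓ} 1≤n 0<ε ρ≤ε³/8 D-large excess
  ℓ≤m/2 : ℓ ≤ m / 2
  ℓ≤m/2 = halve (ℕP.m+n≤o⇒n≤o k k+2ℓ≤m)
  k≤m∸2ℓ : k ≤ m ∸ 2 * ℓ
  k≤m∸2ℓ = ℕP.m+n≤o⇒m≤o∸n k k+2ℓ≤m
  somePart : Fin k ⊎ Fin ℓ
  somePart = proj₁ (cover (fromℕ< 1≤n))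

isHierarchyFn-id : IsHierarchyFn (λ x → x)
isHierarchyFn-id = (λ _ 0<x x≤1 → 0<x , x≤1) , (λ _ _ _ x≤y _ → x≤y)

proposition3p2 : ∃[ f ] (IsHierarchyFn f ×
    (∀ (n D r : ℕ) (ε ρ ν τ : ℚ) →
    1 ≤ n → 2 ≤ r →
    0ℚ ℚ.< ε →
    0ℚ ℚ.< ρ → ρ ℚ.≤ 1ℚ → 0ℚ ℚ.< ν → ν ℚ.≤ 1ℚ → 0ℚ ℚ.< τ → τ ℚ.≤ 1ℚ →
    τ ℚ.≤ f (inv r) → ν ℚ.≤ f τ → ρ ℚ.≤ f ν → inv n ℚ.≤ f ρ →
    ρ ℚ.≤ ν → ν ℚ.≤ τ → τ ℚ.< 1ℚ →
    ρ ℚ.≤ (ε ℚ.* ε ℚ.* ε) ℚ.* ((ℤ.+ 1) ℚ./ 8) →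
    (G : Graph n) → IsRegular G D →
    (inv r ℚ.+ ε) ℚ.* ℕ→ℚ n ℚ.≤ ℕ→ℚ D →
    (k ℓ : ℕ) (V : Fin k → Subset n) (A B : Fin ℓ → Subset n) →
    IsRobustPartition G D ρ ν τ k ℓ V A B →
    (k + 2 * ℓ ≤ r ∸ 1) × (ℓ ≤ (r ∸ 1) / 2) × (k ≤ r ∸ 1 ∸ 2 * ℓ) ×
    (r ≡ 4 → InS k ℓ) × (r ≡ 5 → InS5 k ℓ)))
proposition3p2 = (λ x → x) , isHierarchyFn-id , λ where
  _ _ zero _ _ _ _ _ ()
  n D (suc m) ε ρ ν τ 1≤n _ 0<ε _ _ _ _ _ _ _ _ _ _ _ _ _ ρ≤ε³/8 G _ D-large k ℓ V A B partition →
    robustPartition-bounds {n} {D} {m} {k} {ℓ} {ε} {ρ} {ν} {τ} {G} {V} {A} {B}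
      1≤n 0<ε ρ≤ε³/8 D-large partition
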